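{- In any weak AMD code with $m$ sources over a group of order $n$, the optimal adversarial success probability satisfies $\hat\epsilon^2\ge\frac{m-1}{m(n-1)}$.
   Context: Let $\mathcal{G}$ be a finite additive abelian group of order $n\ge 2$ and $\mathcal{S}$ a set of $m$ sources. An AMD code consists of pairwise disjoint nonempty subsets $A(s)\subseteq\mathcal{G}$ ($s\in\mathcal{S}$) of valid encodings and a (possibly randomized) public encoding function $E$ mapping each source $s$ to some $g\in A(s)$ according to a probability distribution $\Pr[E(s)=g]$ on $A(s)$. Weak security game: the adversary, knowing the code, chooses $\Delta\in\mathcal{G}\setminus\{0\}$ according to a (possibly randomized) strategy $\sigma$; then a source $s$ is chosen uniformly at random from $\mathcal{S}$ and encoded as $g=E(s)$; the adversary wins iff $g+\Delta\in A(s')$ for some $s'\ne s$. $\epsilon_\sigma$ is the winning probability of $\sigma$ and $\hat\epsilon=\max_\sigma\epsilon_\sigma$. -}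

module Defs where

open import Level using (0ℓ)
open import Data.Nat as ℕ using (ℕ; zero; suc; _∸_; NonZero)
open import Data.Integer using (+_)
open import Data.Fin using (Fin; zero; suc)
open import Data.Fin.Subset using (Subset; _∈_; _∉_; Nonempty)
open import Data.Fin.Subset.Properties using (_∈?_)
open import Data.Fin.Properties using (_≟_; any?)
open import Data.Rational using (ℚ; 0ℚ; 1ℚ; _+_; _*_; _/_; _≤_)
open import Data.Product using (_×_; Σ; ∃)
open import Relation.Binary.PropositionalEquality using (_≡_; _≢_)
open import Relation.Nullary using (¬_; yes; no)
open import Relation.Nullary.Decidable using (_×-dec_; ¬?)
open import Algebra.Structures using (IsAbelianGroup)

-- A finite abelian group of order n, presented on the carrier Fin n
-- (every finite abelian group of order n is isomorphic to one of these).
record FinAbGroup (n : ℕ) : Set where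
  field
    _⊕_  : Fin n → Fin n → Fin n
    𝟘    : Fin n
    ⊖_   : Fin n → Fin n
    isAbelianGroup : IsAbelianGroup _≡_ _⊕_ 𝟘 ⊖_

Σℚ : ∀ {k} → (Fin k → ℚ) → ℚ
Σℚ {zero}  f = 0ℚ
Σℚ {suc k} f = f zero + Σℚ (λ i → f (suc i))

-- An AMD code with m sources (Fin m) over the group G of order n.
-- A s  : the set of valid encodings of source s;
-- E s g : Pr[E(s) = g].
record AMDCode {n : ℕ} (G : FinAbGroup n) (m : ℕ) : Set where
  field
    A        : Fin m → Subset n
    nonempty : ∀ s → Nonempty (A s)
    disjoint : ∀ s s' (g : Fin n) → s ≢ s' → g ∈ A s → g ∉ A s'
    E        : Fin m → Fin n → ℚ
    E-nonneg : ∀ s g → 0ℚ ≤ E s g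
    E-supp   : ∀ s g → g ∉ A s → E s g ≡ 0ℚ
    E-sum    : ∀ s → Σℚ (E s) ≡ 1ℚ

record Strategy {n : ℕ} (G : FinAbGroup n) : Set where
  open FinAbGroup G
  field
    σ        : Fin n → ℚ
    σ-nonneg : ∀ Δ → 0ℚ ≤ σ Δ
    σ-zero   : σ 𝟘 ≡ 0ℚ
    σ-sum    : Σℚ σ ≡ 1ℚ

module _ {n : ℕ} {G : FinAbGroup n} {m : ℕ} (C : AMDCode G m) where
  open FinAbGroup G
  open AMDCode C

  wins : Fin m → Fin n → Fin n → ℚ
  wins s g Δ with any? (λ s' → ¬? (s ≟ s') ×-dec ((g ⊕ Δ) ∈? A s'))
  ... | yes _ = 1ℚ
  ... | no  _ = 0ℚ

  -- Winning probability ε_σ in the weak security game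
  -- (source uniform on Fin m, then g = E(s), Δ drawn from σ independently).
  successProb : .{{_ : NonZero m}} → Strategy G → ℚ
  successProb S =
    Σℚ (λ Δ → Strategy.σ S Δ *
      Σℚ (λ s → (+ 1 / m) *
        Σℚ (λ g → E s g * wins s g Δ)))

-- The bound (m-1)/(m(n-1)), for n ≥ 2 (the value for n < 2 is irrelevant).
amdBound : (m n : ℕ) → .{{_ : NonZero m}} → ℚ
amdBound m zero          = 0ℚ
amdBound m (suc zero)    = 0ℚ
amdBound m (suc (suc k)) = (+ (m ∸ 1) / m) * (+ 1 / suc k)

module Submission where

-- Let W(Δ) be the probability mass, summed over the m sources, of the encodings that the
-- shift Δ moves into the set of another source.  Always playing Δ wins with probability
-- W(Δ)/m, and the success probability is linear in the strategy, so the point mass at a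
-- maximiser Δ* ≠ 0 of W is optimal; put M = W(Δ*).  Shifting an encoding of s onto a valid
-- encoding of another source wins, so no encoding has probability above M.  Now fix a
-- source s and an encoding g.  Summed over Δ, the probabilities of all sources being encoded
-- as g + Δ add up to m; a winning Δ contributes that of a single other source (at most M),
-- a losing one only that of s, whence m ≤ M·#{winning Δ} + 1.  Averaging over g and summing
-- over s gives m² ≤ M·Σ_Δ W(Δ) + m ≤ M²(n − 1) + m, as W(0) = 0; that is,
-- (m − 1)/(m(n − 1)) ≤ (M/m)².

open import Defs

open import Level using (0ℓ)
open import Data.Nat as ℕ using (ℕ; zero; suc; NonZero; z≤n; s≤s)
import Data.Nat.Properties as ℕ
open import Data.Nat.Coprimality using (1-coprimeTo) renaming (sym to coprime-sym)
open import Data.Integer as ℤ using (+_)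
import Data.Integer.Properties as ℤ
open import Data.Fin using (Fin; zero; suc; punchIn)
open import Data.Fin.Properties using (_≟_; any?; punchInᵢ≢i)
open import Data.Fin.Subset using (_∈_; _∉_)
open import Data.Fin.Subset.Properties using (_∈?_)
open import Data.Fin.Permutation using (Permutation; permutation; _⟨$⟩ʳ_)
open import Data.List using (List; allFin; filter)
open import Data.List.Membership.Propositional.Properties using (∈-allFin; ∈-filter⁺)
import Data.List.Relation.Unary.All as All
open import Data.List.Relation.Unary.All.Properties using (all-filter)
import Data.List.Extrema as Extrema
open import Data.Rational using (ℚ; 0ℚ; 1ℚ; _+_; _*_; -_; _/_; 1/_; _≤_; Positive; nonNegative)
open import Data.Rational.Literals using (fromℤ)
open import Data.Rational.Properties hiding (_≟_)
open import Data.Rational.Solver using (module +-*-Solver)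
open import Data.Product using (Σ; ∃; _×_; _,_)
open import Data.Empty using (⊥-elim)
open import Relation.Binary.PropositionalEquality
open import Relation.Binary.Bundles using (DecTotalOrder)
open import Relation.Nullary using (Dec; yes; no; ¬?)
open import Relation.Nullary.Decidable using (_×-dec_)
open import Algebra.Bundles using (Group; CommutativeRing)
open import Algebra.Structures using (IsAbelianGroup)
import Algebra.Properties.Group as GroupProperties
import Algebra.Properties.Semiring.Sum as SemiringSum

fromℕ : ℕ → ℚ
fromℕ k = fromℤ (+ k)

-- On the canonical forms fromℕ and 1/_, ℚ's _+_ and _*_ compute to a quotient _/_.
fromℕ-suc : ∀ k → fromℕ (suc k) ≡ 1ℚ + fromℕ k
fromℕ-suc k = begin
  fromℕ (suc k)  ≡⟨ normalize-coprime (coprime-sym (1-coprimeTo (suc k))) ⟨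
  + suc k / 1    ≡⟨ /-cong (cong (ℤ._+_ (+ 1)) (ℤ.*-identityʳ (+ k))) refl ⟨
  1ℚ + fromℕ k   ∎
  where open ≡-Reasoning

i/n≡i*1/n : ∀ i n → + i / suc n ≡ fromℕ i * 1/ fromℕ (suc n)
i/n≡i*1/n i n = sym (/-cong (ℤ.*-identityʳ (+ i)) (ℕ.*-identityˡ (suc n)))

i/n*n≡i : ∀ i n → + i / suc n * fromℕ (suc n) ≡ fromℕ i
i/n*n≡i i n = begin
  + i / suc n * fromℕ (suc n)                  ≡⟨ cong (_* fromℕ (suc n)) (i/n≡i*1/n i n) ⟩
  fromℕ i * 1/ fromℕ (suc n) * fromℕ (suc n)   ≡⟨ *-assoc (fromℕ i) (1/ fromℕ (suc n)) (fromℕ (suc n)) ⟩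
  fromℕ i * (1/ fromℕ (suc n) * fromℕ (suc n)) ≡⟨ cong (fromℕ i *_) (*-inverseˡ (fromℕ (suc n))) ⟩
  fromℕ i * 1ℚ                                 ≡⟨ *-identityʳ (fromℕ i) ⟩
  fromℕ i                                      ∎
  where open ≡-Reasoning

+-cancelʳ-≤ : ∀ {p q} r → p + r ≤ q + r → p ≤ q
+-cancelʳ-≤ {p} {q} r p+r≤q+r = subst₂ _≤_ (cancel p) (cancel q) (+-monoˡ-≤ (- r) p+r≤q+r)
  where
  cancel : ∀ x → x + r + - r ≡ x
  cancel x = trans (+-assoc x r (- r)) (trans (cong (_+_ x) (+-inverseʳ r)) (+-identityʳ x))

open SemiringSum (CommutativeRing.semiring +-*-commutativeRing)
  using (sum; sum-cong-≗; ∑-distrib-+; ∑-comm; sum-permute; sum-remove;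
         *-distribˡ-sum; *-distribʳ-sum)

Σℚ≡sum : ∀ {k} (f : Fin k → ℚ) → Σℚ f ≡ sum f
Σℚ≡sum {zero}  f = refl
Σℚ≡sum {suc k} f = cong (_+_ (f zero)) (Σℚ≡sum (λ i → f (suc i)))

Σℚ-from-sum : ∀ {k l} (f : Fin k → ℚ) (g : Fin l → ℚ) → sum f ≡ sum g → Σℚ f ≡ Σℚ g
Σℚ-from-sum f g eq = trans (Σℚ≡sum f) (trans eq (sym (Σℚ≡sum g)))

Σ-cong : ∀ {k} {f g : Fin k → ℚ} → (∀ i → f i ≡ g i) → Σℚ f ≡ Σℚ g
Σ-cong {f = f} {g} f≗g = Σℚ-from-sum f g (sum-cong-≗ f≗g)

Σ-+ : ∀ {k} (f g : Fin k → ℚ) → Σℚ (λ i → f i + g i) ≡ Σℚ f + Σℚ g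
Σ-+ f g = trans (Σℚ≡sum (λ i → f i + g i))
                (trans (∑-distrib-+ f g) (sym (cong₂ _+_ (Σℚ≡sum f) (Σℚ≡sum g))))

Σ-*ˡ : ∀ {k} c (f : Fin k → ℚ) → Σℚ (λ i → c * f i) ≡ c * Σℚ f
Σ-*ˡ c f = trans (Σℚ≡sum (λ i → c * f i))
                 (trans (sym (*-distribˡ-sum c f)) (cong (c *_) (sym (Σℚ≡sum f))))

Σ-*ʳ : ∀ {k} c (f : Fin k → ℚ) → Σℚ (λ i → f i * c) ≡ Σℚ f * c
Σ-*ʳ c f = trans (Σℚ≡sum (λ i → f i * c))
                 (trans (sym (*-distribʳ-sum c f)) (cong (_* c) (sym (Σℚ≡sum f))))

Σ-linear : ∀ {k} a (f g : Fin k → ℚ) → Σℚ (λ i → a * f i + g i) ≡ a * Σℚ f + Σℚ g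
Σ-linear a f g = trans (Σ-+ (λ i → a * f i) g) (cong (_+ Σℚ g) (Σ-*ˡ a f))

Σ-comm : ∀ {k l} (f : Fin k → Fin l → ℚ) →
         Σℚ (λ i → Σℚ (λ j → f i j)) ≡ Σℚ (λ j → Σℚ (λ i → f i j))
Σ-comm f = begin
  Σℚ (λ i → Σℚ (λ j → f i j))  ≡⟨ Σ-cong (λ i → Σℚ≡sum (f i)) ⟩
  Σℚ (λ i → sum (λ j → f i j)) ≡⟨ Σℚ-from-sum (λ i → sum (f i)) (λ j → sum (λ i → f i j)) (∑-comm f) ⟩
  Σℚ (λ j → sum (λ i → f i j)) ≡⟨ Σ-cong (λ j → Σℚ≡sum (λ i → f i j)) ⟨
  Σℚ (λ j → Σℚ (λ i → f i j))  ∎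
  where open ≡-Reasoning

Σ-permute : ∀ {k} (f : Fin k → ℚ) (π : Permutation k k) → Σℚ f ≡ Σℚ (λ i → f (π ⟨$⟩ʳ i))
Σ-permute f π = Σℚ-from-sum f (λ i → f (π ⟨$⟩ʳ i)) (sum-permute f π)

Σ-remove : ∀ {k} (f : Fin (suc k) → ℚ) i → Σℚ f ≡ f i + Σℚ (λ j → f (punchIn i j))
Σ-remove f i = trans (Σℚ≡sum f)
                     (trans (sum-remove f) (cong (_+_ (f i)) (sym (Σℚ≡sum (λ j → f (punchIn i j))))))

Σ-const : ∀ k c → Σℚ {k} (λ _ → c) ≡ fromℕ k * c
Σ-const zero    c = sym (*-zeroˡ c)
Σ-const (suc k) c = begin
  c + Σℚ {k} (λ _ → c)  ≡⟨ cong₂ _+_ (sym (*-identityˡ c)) (Σ-const k c) ⟩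
  1ℚ * c + fromℕ k * c  ≡⟨ *-distribʳ-+ c 1ℚ (fromℕ k) ⟨
  (1ℚ + fromℕ k) * c    ≡⟨ cong (_* c) (fromℕ-suc k) ⟨
  fromℕ (suc k) * c     ∎
  where open ≡-Reasoning

Σ-ones : ∀ k → Σℚ {k} (λ _ → 1ℚ) ≡ fromℕ k
Σ-ones k = trans (Σ-const k 1ℚ) (*-identityʳ (fromℕ k))

Σ-zero : ∀ {k} {f : Fin k → ℚ} → (∀ i → f i ≡ 0ℚ) → Σℚ f ≡ 0ℚ
Σ-zero {k} f≗0 = trans (Σ-cong f≗0) (trans (Σ-const k 0ℚ) (*-zeroʳ (fromℕ k)))

Σ-supported : ∀ {k} {f : Fin k → ℚ} i → (∀ j → j ≢ i → f j ≡ 0ℚ) → Σℚ f ≡ f i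
Σ-supported {suc k} {f} i vanishes = begin
  Σℚ f                             ≡⟨ Σ-remove f i ⟩
  f i + Σℚ (λ j → f (punchIn i j)) ≡⟨ cong (_+_ (f i)) (Σ-zero (λ j → vanishes _ (punchInᵢ≢i i j))) ⟩
  f i + 0ℚ                         ≡⟨ +-identityʳ (f i) ⟩
  f i                              ∎
  where open ≡-Reasoning

Σ-mono : ∀ {k} {f g : Fin k → ℚ} → (∀ i → f i ≤ g i) → Σℚ f ≤ Σℚ g
Σ-mono {zero}  f≤g = ≤-refl
Σ-mono {suc k} f≤g = +-mono-≤ (f≤g zero) (Σ-mono (λ i → f≤g (suc i)))

Σ-nonneg : ∀ {k} {f : Fin k → ℚ} → (∀ i → 0ℚ ≤ f i) → 0ℚ ≤ Σℚ f
Σ-nonneg {zero}  0≤f = ≤-refl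
Σ-nonneg {suc k} 0≤f = +-mono-≤ (0≤f zero) (Σ-nonneg (λ i → 0≤f (suc i)))

term≤Σ : ∀ {k} {f : Fin k → ℚ} → (∀ i → 0ℚ ≤ f i) → ∀ i → f i ≤ Σℚ f
term≤Σ {suc k} {f} 0≤f i = begin
  f i                              ≡⟨ +-identityʳ (f i) ⟨
  f i + 0ℚ                         ≤⟨ +-monoʳ-≤ (f i) (Σ-nonneg (λ j → 0≤f (punchIn i j))) ⟩
  f i + Σℚ (λ j → f (punchIn i j)) ≡⟨ Σ-remove f i ⟨
  Σℚ f                             ∎
  where open ≤-Reasoning

Σ-≤-punctured : ∀ {k} {f : Fin k → ℚ} {c} i → f i ≡ 0ℚ → (∀ j → f j ≤ c) →
                Σℚ f ≤ fromℕ (ℕ.pred k) * c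
Σ-≤-punctured {suc k} {f} {c} i fi≡0 f≤c = begin
  Σℚ f                             ≡⟨ Σ-remove f i ⟩
  f i + Σℚ (λ j → f (punchIn i j)) ≡⟨ cong (_+ Σℚ (λ j → f (punchIn i j))) fi≡0 ⟩
  0ℚ + Σℚ (λ j → f (punchIn i j))  ≡⟨ +-identityˡ _ ⟩
  Σℚ (λ j → f (punchIn i j))       ≤⟨ Σ-mono (λ j → f≤c (punchIn i j)) ⟩
  Σℚ {k} (λ _ → c)                 ≡⟨ Σ-const k c ⟩
  fromℕ k * c                      ∎
  where open ≤-Reasoning

Σ-weighted-mono : ∀ {k} {w f g : Fin k → ℚ} → (∀ i → 0ℚ ≤ w i) → (∀ i → f i ≤ g i) →
                  Σℚ (λ i → w i * f i) ≤ Σℚ (λ i → w i * g i)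
Σ-weighted-mono {w = w} 0≤w f≤g = Σ-mono (λ i → *-monoˡ-≤-nonNeg (w i) {{nonNegative (0≤w i)}} (f≤g i))

Σ-convex-≤ : ∀ {k} {w f : Fin k → ℚ} {c} → (∀ i → 0ℚ ≤ w i) → Σℚ w ≡ 1ℚ →
             (∀ i → f i ≤ c) → Σℚ (λ i → w i * f i) ≤ c
Σ-convex-≤ {w = w} {f} {c} 0≤w Σw≡1 f≤c = begin
  Σℚ (λ i → w i * f i) ≤⟨ Σ-weighted-mono 0≤w f≤c ⟩
  Σℚ (λ i → w i * c)   ≡⟨ Σ-*ʳ c w ⟩
  Σℚ w * c             ≡⟨ cong (_* c) Σw≡1 ⟩
  1ℚ * c               ≡⟨ *-identityˡ c ⟩
  c                    ∎
  where open ≤-Reasoning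

≤-Σ-convex : ∀ {k} {w f : Fin k → ℚ} {c} → (∀ i → 0ℚ ≤ w i) → Σℚ w ≡ 1ℚ →
             (∀ i → c ≤ f i) → c ≤ Σℚ (λ i → w i * f i)
≤-Σ-convex {w = w} {f} {c} 0≤w Σw≡1 c≤f = begin
  c                    ≡⟨ *-identityˡ c ⟨
  1ℚ * c               ≡⟨ cong (_* c) Σw≡1 ⟨
  Σℚ w * c             ≡⟨ Σ-*ʳ c w ⟨
  Σℚ (λ i → w i * c)   ≤⟨ Σ-weighted-mono 0≤w c≤f ⟩
  Σℚ (λ i → w i * f i) ∎
  where open ≤-Reasoning

pointMass : ∀ {k} → Fin k → Fin k → ℚ
pointMass i j with j ≟ i
... | yes _ = 1ℚ
... | no  _ = 0ℚ

Σ-pointMass-* : ∀ {k} i (f : Fin k → ℚ) → Σℚ (λ j → pointMass i j * f j) ≡ f i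
Σ-pointMass-* i f = trans (Σ-supported i vanishes) at-i
  where
  vanishes : ∀ j → j ≢ i → pointMass i j * f j ≡ 0ℚ
  vanishes j j≢i with j ≟ i
  ... | yes j≡i = ⊥-elim (j≢i j≡i)
  ... | no  _   = *-zeroˡ (f j)
  at-i : pointMass i i * f i ≡ f i
  at-i with i ≟ i
  ... | yes _   = *-identityˡ (f i)
  ... | no  i≢i = ⊥-elim (i≢i refl)

argmax-≢ : ∀ {k} → 2 ℕ.≤ k → (f : Fin k → ℚ) (z : Fin k) →
           ∃ λ y → y ≢ z × (∀ x → x ≢ z → f x ≤ f y)
argmax-≢ {k} (s≤s (s≤s z≤n)) f z = y , y≢z , maximal
  where
  open Extrema (DecTotalOrder.totalOrder ≤-decTotalOrder) using (argmax; argmax-all; f[xs]≤f[argmax])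
  others : List (Fin k)
  others = filter (λ x → ¬? (x ≟ z)) (allFin k)
  y : Fin k
  y = argmax f (punchIn z zero) others
  y≢z : y ≢ z
  y≢z = argmax-all f (punchInᵢ≢i z zero) (all-filter (λ x → ¬? (x ≟ z)) (allFin k))
  maximal : ∀ x → x ≢ z → f x ≤ f y
  maximal x x≢z = All.lookup (f[xs]≤f[argmax] (punchIn z zero) others)
                             (∈-filter⁺ (λ x → ¬? (x ≟ z)) (∈-allFin x) x≢z)

group : ∀ {n} → FinAbGroup n → Group 0ℓ 0ℓ
group G = record { isGroup = IsAbelianGroup.isGroup (FinAbGroup.isAbelianGroup G) }

module _ {n} (G : FinAbGroup n) where
  open FinAbGroup G
  open GroupProperties (group G) using (\\-leftDividesˡ; \\-leftDividesʳ)

  translation : Fin n → Permutation n n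
  translation g = permutation (g ⊕_) (_⊕_ (⊖ g)) (\\-leftDividesˡ g) (\\-leftDividesʳ g)

  Σ-translate : ∀ g (φ : Fin n → ℚ) → Σℚ φ ≡ Σℚ (λ Δ → φ (g ⊕ Δ))
  Σ-translate g φ = Σ-permute φ (translation g)

  pointStrategy : (Δ : Fin n) → Δ ≢ 𝟘 → Strategy G
  pointStrategy Δ Δ≢𝟘 = record
    { σ        = pointMass Δ
    ; σ-nonneg = nonneg
    ; σ-zero   = at-𝟘
    ; σ-sum    = trans (Σ-cong (λ Δ' → sym (*-identityʳ (pointMass Δ Δ')))) (Σ-pointMass-* Δ (λ _ → 1ℚ))
    }
    where
    nonneg : ∀ Δ' → 0ℚ ≤ pointMass Δ Δ'
    nonneg Δ' with Δ' ≟ Δ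
    ... | yes _ = nonNegative⁻¹ 1ℚ
    ... | no  _ = ≤-refl
    at-𝟘 : pointMass Δ 𝟘 ≡ 0ℚ
    at-𝟘 with 𝟘 ≟ Δ
    ... | yes 𝟘≡Δ = ⊥-elim (Δ≢𝟘 (sym 𝟘≡Δ))
    ... | no  _   = refl

module AMDCodeProperties {n} {G : FinAbGroup n} {m} (C : AMDCode G m) where
  open FinAbGroup G
  open AMDCode C
  open GroupProperties (group G) using (\\-leftDividesˡ)
  open IsAbelianGroup isAbelianGroup using (identityʳ)

  otherSourceAt? : ∀ s h → Dec (∃ λ s' → s ≢ s' × h ∈ A s')
  otherSourceAt? s h = any? (λ s' → ¬? (s ≟ s') ×-dec (h ∈? A s'))

  wins≡1 : ∀ {s s' g Δ} → s ≢ s' → g ⊕ Δ ∈ A s' → wins C s g Δ ≡ 1ℚ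
  wins≡1 {s} {s'} {g} {Δ} s≢s' hit with otherSourceAt? s (g ⊕ Δ)
  ... | yes _     = refl
  ... | no  ¬hits = ⊥-elim (¬hits (s' , s≢s' , hit))

  wins≡0 : ∀ {s g Δ} → (∀ s' → s ≢ s' → g ⊕ Δ ∉ A s') → wins C s g Δ ≡ 0ℚ
  wins≡0 {s} {g} {Δ} miss with otherSourceAt? s (g ⊕ Δ)
  ... | yes (s' , s≢s' , hit) = ⊥-elim (miss s' s≢s' hit)
  ... | no  _                 = refl

  0≤wins : ∀ s g Δ → 0ℚ ≤ wins C s g Δ
  0≤wins s g Δ with otherSourceAt? s (g ⊕ Δ)
  ... | yes _ = nonNegative⁻¹ 1ℚ
  ... | no  _ = ≤-refl

  0≤E*wins : ∀ s g Δ → 0ℚ ≤ E s g * wins C s g Δ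
  0≤E*wins s g Δ = nonNegative⁻¹ _
    {{nonNeg*nonNeg⇒nonNeg (E s g) {{nonNegative (E-nonneg s g)}} _ {{nonNegative (0≤wins s g Δ)}}}}

  -- m times the success probability ε_Δ of always playing Δ.
  winMass : Fin n → ℚ
  winMass Δ = Σℚ (λ s → Σℚ (λ g → E s g * wins C s g Δ))

  0≤winMass : ∀ Δ → 0ℚ ≤ winMass Δ
  0≤winMass Δ = Σ-nonneg (λ s → Σ-nonneg (λ g → 0≤E*wins s g Δ))

  E*wins≤winMass : ∀ s g Δ → E s g * wins C s g Δ ≤ winMass Δ
  E*wins≤winMass s g Δ = ≤-trans (term≤Σ (λ g → 0≤E*wins s g Δ) g)
                                 (term≤Σ (λ s → Σ-nonneg (λ g → 0≤E*wins s g Δ)) s)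

  E≤winMass : ∀ {s s' g h} → s ≢ s' → h ∈ A s' → E s g ≤ winMass ((⊖ g) ⊕ h)
  E≤winMass {s} {s'} {g} {h} s≢s' h∈A = begin
    E s g                          ≡⟨ *-identityʳ (E s g) ⟨
    E s g * 1ℚ                     ≡⟨ cong (E s g *_) (wins≡1 s≢s' g⊕[⊖g⊕h]∈A) ⟨
    E s g * wins C s g ((⊖ g) ⊕ h) ≤⟨ E*wins≤winMass s g ((⊖ g) ⊕ h) ⟩
    winMass ((⊖ g) ⊕ h)            ∎
    where
    open ≤-Reasoning
    g⊕[⊖g⊕h]∈A : g ⊕ ((⊖ g) ⊕ h) ∈ A s'
    g⊕[⊖g⊕h]∈A = subst (_∈ A s') (sym (\\-leftDividesˡ g h)) h∈A

  winMass-𝟘 : winMass 𝟘 ≡ 0ℚ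
  winMass-𝟘 = Σ-zero (λ s → Σ-zero (λ g → no-win s g))
    where
    no-win : ∀ s g → E s g * wins C s g 𝟘 ≡ 0ℚ
    no-win s g with g ∈? A s
    ... | yes g∈A = trans (cong (E s g *_) (wins≡0 (λ s' s≢s' g⊕𝟘∈A →
                      disjoint s s' g s≢s' g∈A (subst (_∈ A s') (identityʳ g) g⊕𝟘∈A))))
                          (*-zeroʳ (E s g))
    ... | no  g∉A = trans (cong (_* wins C s g 𝟘) (E-supp s g g∉A)) (*-zeroˡ (wins C s g 𝟘))

  mass : Fin n → ℚ
  mass h = Σℚ (λ s → E s h)

  Σ-mass : Σℚ mass ≡ fromℕ m
  Σ-mass = begin
    Σℚ (λ h → Σℚ (λ s → E s h)) ≡⟨ Σ-comm (λ h s → E s h) ⟩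
    Σℚ (λ s → Σℚ (E s))         ≡⟨ Σ-cong E-sum ⟩
    Σℚ {m} (λ _ → 1ℚ)           ≡⟨ Σ-ones m ⟩
    fromℕ m                     ∎
    where open ≡-Reasoning

  expectedWins : Fin m → ℚ
  expectedWins s = Σℚ (λ g → E s g * Σℚ (wins C s g))

  Σ-winMass : Σℚ winMass ≡ Σℚ expectedWins
  Σ-winMass = begin
    Σℚ (λ Δ → Σℚ (λ s → Σℚ (λ g → E s g * wins C s g Δ)))
      ≡⟨ Σ-comm (λ Δ s → Σℚ (λ g → E s g * wins C s g Δ)) ⟩
    Σℚ (λ s → Σℚ (λ Δ → Σℚ (λ g → E s g * wins C s g Δ)))
      ≡⟨ Σ-cong (λ s → Σ-comm (λ Δ g → E s g * wins C s g Δ)) ⟩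
    Σℚ (λ s → Σℚ (λ g → Σℚ (λ Δ → E s g * wins C s g Δ)))
      ≡⟨ Σ-cong (λ s → Σ-cong (λ g → Σ-*ˡ (E s g) (wins C s g))) ⟩
    Σℚ expectedWins
      ∎
    where open ≡-Reasoning

  module _ {M} (winMass≤M : ∀ Δ → winMass Δ ≤ M) where

    E≤M : ∀ {s s'} g → s ≢ s' → E s g ≤ M
    E≤M {s' = s'} g s≢s' with nonempty s'
    ... | h , h∈A = ≤-trans (E≤winMass s≢s' h∈A) (winMass≤M ((⊖ g) ⊕ h))

    mass≤M*wins+E : ∀ s g Δ → mass (g ⊕ Δ) ≤ M * wins C s g Δ + E s (g ⊕ Δ)
    mass≤M*wins+E s g Δ = by-cases (otherSourceAt? s h)
      where
      open ≤-Reasoning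
      h : Fin n
      h = g ⊕ Δ
      by-cases : Dec (∃ λ s' → s ≢ s' × h ∈ A s') → mass h ≤ M * wins C s g Δ + E s h
      by-cases (yes (s' , s≢s' , h∈A)) = begin
        mass h                   ≡⟨ Σ-supported s' (λ s'' s''≢s' →
                                      E-supp s'' h (disjoint s' s'' h (≢-sym s''≢s') h∈A)) ⟩
        E s' h                   ≤⟨ E≤M h (≢-sym s≢s') ⟩
        M                        ≡⟨ trans (+-identityʳ (M * 1ℚ)) (*-identityʳ M) ⟨
        M * 1ℚ + 0ℚ              ≡⟨ cong₂ (λ w e → M * w + e) (wins≡1 s≢s' h∈A)
                                      (E-supp s h (disjoint s' s h (≢-sym s≢s') h∈A)) ⟨
        M * wins C s g Δ + E s h ∎
      by-cases (no ¬hits) = begin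
        mass h                   ≡⟨ Σ-supported s (λ s' s'≢s →
                                      E-supp s' h (λ h∈A → ¬hits (s' , ≢-sym s'≢s , h∈A))) ⟩
        E s h                    ≡⟨ trans (cong (_+ E s h) (*-zeroʳ M)) (+-identityˡ (E s h)) ⟨
        M * 0ℚ + E s h           ≡⟨ cong (λ w → M * w + E s h)
                                      (wins≡0 (λ s' s≢s' h∈A → ¬hits (s' , s≢s' , h∈A))) ⟨
        M * wins C s g Δ + E s h ∎

    m≤M*Σwins+1 : ∀ s g → fromℕ m ≤ M * Σℚ (wins C s g) + 1ℚ
    m≤M*Σwins+1 s g = begin
      fromℕ m                                      ≡⟨ Σ-mass ⟨
      Σℚ mass                                      ≡⟨ Σ-translate G g mass ⟩
      Σℚ (λ Δ → mass (g ⊕ Δ))                      ≤⟨ Σ-mono (mass≤M*wins+E s g) ⟩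
      Σℚ (λ Δ → M * wins C s g Δ + E s (g ⊕ Δ))    ≡⟨ Σ-linear M (wins C s g) (λ Δ → E s (g ⊕ Δ)) ⟩
      M * Σℚ (wins C s g) + Σℚ (λ Δ → E s (g ⊕ Δ)) ≡⟨ cong (_+_ (M * Σℚ (wins C s g))) Σ-E-shifted ⟩
      M * Σℚ (wins C s g) + 1ℚ                     ∎
      where
      open ≤-Reasoning
      Σ-E-shifted : Σℚ (λ Δ → E s (g ⊕ Δ)) ≡ 1ℚ
      Σ-E-shifted = trans (sym (Σ-translate G g (E s))) (E-sum s)

    m≤M*expectedWins+1 : ∀ s → fromℕ m ≤ M * expectedWins s + 1ℚ
    m≤M*expectedWins+1 s = begin
      fromℕ m
        ≤⟨ ≤-Σ-convex (E-nonneg s) (E-sum s) (m≤M*Σwins+1 s) ⟩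
      Σℚ (λ g → E s g * (M * Σℚ (wins C s g) + 1ℚ))
        ≡⟨ Σ-cong (λ g → spread (E s g) M (Σℚ (wins C s g))) ⟩
      Σℚ (λ g → M * (E s g * Σℚ (wins C s g)) + E s g)
        ≡⟨ Σ-linear M (λ g → E s g * Σℚ (wins C s g)) (E s) ⟩
      M * expectedWins s + Σℚ (E s)
        ≡⟨ cong (_+_ (M * expectedWins s)) (E-sum s) ⟩
      M * expectedWins s + 1ℚ
        ∎
      where
      open ≤-Reasoning
      open +-*-Solver
      spread : ∀ e a w → e * (a * w + 1ℚ) ≡ a * (e * w) + e
      spread = solve 3 (λ e a w → e :* (a :* w :+ con 1ℚ) := a :* (e :* w) :+ e) refl

    m*m≤M*M*[n-1]+m : fromℕ m * fromℕ m ≤ M * M * fromℕ (ℕ.pred n) + fromℕ m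
    m*m≤M*M*[n-1]+m = begin
      fromℕ m * fromℕ m                       ≡⟨ Σ-const m (fromℕ m) ⟨
      Σℚ {m} (λ _ → fromℕ m)                  ≤⟨ Σ-mono m≤M*expectedWins+1 ⟩
      Σℚ (λ s → M * expectedWins s + 1ℚ)      ≡⟨ Σ-linear M expectedWins (λ _ → 1ℚ) ⟩
      M * Σℚ expectedWins + Σℚ {m} (λ _ → 1ℚ) ≡⟨ cong₂ (λ x y → M * x + y) (sym Σ-winMass) (Σ-ones m) ⟩
      M * Σℚ winMass + fromℕ m                ≤⟨ +-monoˡ-≤ (fromℕ m) M*Σ-winMass≤ ⟩
      M * (fromℕ (ℕ.pred n) * M) + fromℕ m    ≡⟨ cong (_+ fromℕ m) (reorder M (fromℕ (ℕ.pred n))) ⟩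
      M * M * fromℕ (ℕ.pred n) + fromℕ m      ∎
      where
      open ≤-Reasoning
      0≤M : 0ℚ ≤ M
      0≤M = ≤-trans (0≤winMass 𝟘) (winMass≤M 𝟘)
      M*Σ-winMass≤ : M * Σℚ winMass ≤ M * (fromℕ (ℕ.pred n) * M)
      M*Σ-winMass≤ = *-monoˡ-≤-nonNeg M {{nonNegative 0≤M}} (Σ-≤-punctured 𝟘 winMass-𝟘 winMass≤M)
      open +-*-Solver
      reorder : ∀ a b → a * (b * a) ≡ a * a * b
      reorder = solve 2 (λ a b → a :* (b :* a) := a :* a :* b) refl

  maximalShift : 2 ℕ.≤ n → ∃ λ Δ* → Δ* ≢ 𝟘 × (∀ Δ → winMass Δ ≤ winMass Δ*)
  maximalShift 2≤n with argmax-≢ 2≤n winMass 𝟘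
  ... | Δ* , Δ*≢𝟘 , maximal = Δ* , Δ*≢𝟘 , bounded
    where
    bounded : ∀ Δ → winMass Δ ≤ winMass Δ*
    bounded Δ with Δ ≟ 𝟘
    ... | yes refl = subst (_≤ winMass Δ*) (sym winMass-𝟘) (0≤winMass Δ*)
    ... | no  Δ≢𝟘  = maximal Δ Δ≢𝟘

  module _ .{{_ : NonZero m}} where

    winProb : Fin n → ℚ
    winProb Δ = Σℚ (λ s → + 1 / m * Σℚ (λ g → E s g * wins C s g Δ))

    winProb≡ : ∀ Δ → winProb Δ ≡ + 1 / m * winMass Δ
    winProb≡ Δ = Σ-*ˡ (+ 1 / m) (λ s → Σℚ (λ g → E s g * wins C s g Δ))

    successProb-pointStrategy : ∀ {Δ} (Δ≢𝟘 : Δ ≢ 𝟘) →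
                                successProb C (pointStrategy G Δ Δ≢𝟘) ≡ + 1 / m * winMass Δ
    successProb-pointStrategy {Δ} _ = trans (Σ-pointMass-* Δ winProb) (winProb≡ Δ)

    pointStrategy-optimal : ∀ {Δ*} (Δ*≢𝟘 : Δ* ≢ 𝟘) → (∀ Δ → winMass Δ ≤ winMass Δ*) →
                            ∀ S → successProb C S ≤ successProb C (pointStrategy G Δ* Δ*≢𝟘)
    pointStrategy-optimal {Δ*} Δ*≢𝟘 maximal S =
      subst (successProb C S ≤_) (sym (Σ-pointMass-* Δ* winProb)) (Σ-convex-≤ σ-nonneg σ-sum winProb≤)
      where
      open Strategy S
      winProb≤ : ∀ Δ → winProb Δ ≤ winProb Δ*
      winProb≤ Δ = subst₂ _≤_ (sym (winProb≡ Δ)) (sym (winProb≡ Δ*))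
                     (*-monoˡ-≤-nonNeg (+ 1 / m) {{normalize-nonNeg 1 m}} (maximal Δ))

amdBound≤square : ∀ m' k M →
  fromℕ (suc m') * fromℕ (suc m') ≤ M * M * fromℕ (suc k) + fromℕ (suc m') →
  amdBound (suc m') (suc (suc k)) ≤ (+ 1 / suc m' * M) * (+ 1 / suc m' * M)
amdBound≤square m' k M quadratic = *-cancelʳ-≤-pos r {{r-pos}} (begin
  + m' / suc m' * v * r               ≡⟨ regroup (+ m' / suc m') v m m n-1 ⟩
  (+ m' / suc m' * m) * m * (v * n-1) ≡⟨ cong₂ (λ x y → x * m * y) (i/n*n≡i m' m') (i/n*n≡i 1 k) ⟩
  fromℕ m' * m * 1ℚ                   ≡⟨ *-identityʳ (fromℕ m' * m) ⟩
  fromℕ m' * m                        ≤⟨ +-cancelʳ-≤ m (subst (_≤ M * M * n-1 + m) m*m≡ quadratic) ⟩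
  M * M * n-1                         ≡⟨ *-identityˡ (M * M * n-1) ⟨
  1ℚ * (M * M * n-1)                  ≡⟨ cong (_* (M * M * n-1)) (*-identityˡ 1ℚ) ⟨
  1ℚ * 1ℚ * (M * M * n-1)             ≡⟨ cong (λ x → x * x * (M * M * n-1)) (i/n*n≡i 1 m') ⟨
  (u * m) * (u * m) * (M * M * n-1)   ≡⟨ exchange u M m n-1 ⟩
  (u * M) * (u * M) * r               ∎)
  where
  open ≤-Reasoning
  open +-*-Solver
  m n-1 u v r : ℚ
  m   = fromℕ (suc m')
  n-1 = fromℕ (suc k)
  u   = + 1 / suc m'
  v   = + 1 / suc k
  r   = m * m * n-1
  r-pos : Positive r
  r-pos = pos*pos⇒pos (m * m) {{pos*pos⇒pos m m}} n-1
  regroup : ∀ a b c d e → a * b * (c * d * e) ≡ (a * c) * d * (b * e)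
  regroup = solve 5 (λ a b c d e → a :* b :* (c :* d :* e) := (a :* c) :* d :* (b :* e)) refl
  exchange : ∀ a b c d → a * c * (a * c) * (b * b * d) ≡ a * b * (a * b) * (c * c * d)
  exchange = solve 4 (λ a b c d → a :* c :* (a :* c) :* (b :* b :* d)
                               := a :* b :* (a :* b) :* (c :* c :* d)) refl
  m*m≡ : m * m ≡ fromℕ m' * m + m
  m*m≡ = trans (cong (_* m) (fromℕ-suc m')) (distrib (fromℕ m') m)
    where
    distrib : ∀ a b → (1ℚ + a) * b ≡ a * b + b
    distrib = solve 2 (λ a b → (con 1ℚ :+ a) :* b := a :* b :+ b) refl

mainTheorem6 : (n : ℕ) → 2 ℕ.≤ n → (G : FinAbGroup n) →
    (m : ℕ) → .{{_ : NonZero m}} → (C : AMDCode G m) →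
    Σ (Strategy G) (λ S →
    (∀ (S' : Strategy G) → successProb C S' ≤ successProb C S) ×
    (amdBound m n ≤ successProb C S * successProb C S))
mainTheorem6 (suc (suc k)) 2≤n@(s≤s (s≤s z≤n)) G (suc m') C =
  let open AMDCodeProperties C
      (Δ* , Δ*≢𝟘 , maximal) = maximalShift 2≤n
      ε*≡ : successProb C (pointStrategy G Δ* Δ*≢𝟘) ≡ + 1 / suc m' * winMass Δ*
      ε*≡ = successProb-pointStrategy Δ*≢𝟘
  in  pointStrategy G Δ* Δ*≢𝟘
    , pointStrategy-optimal Δ*≢𝟘 maximal
    , subst (amdBound (suc m') (suc (suc k)) ≤_) (sym (cong₂ _*_ ε*≡ ε*≡))
            (amdBound≤square m' k (winMass Δ*) (m*m≤M*M*[n-1]+m maximal))
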